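{- Let $(R,U,X)$ be a concordance space. Then: (i) for all $r\in R$, $\{r\}\in U$ and $\{r\}\in X$; (ii) $U$ and $X$ are downward closed in $\mathcal{P}(R)$: if $u\in U$ and $u'\subseteq u$ then $u'\in U$, and likewise for $X$; (iii) $U=(U^{\circ})^{\circ}$ and $X=(X^{\circ})^{\circ}$; (iv) for all $r,r'\in R$, $\{r,r'\}\in U$ or $\{r,r'\}\in X$, and if $r\neq r'$ exactly one of these holds; (v) $u\in U$ if and only if $\{r,r'\}\in U$ for all $r,r'\in u$; and similarly, $x\in X$ if and only if $\{r,r'\}\in X$ for all $r,r'\in x$.
   Context: For a set $R$ and subsets $u,x\subseteq R$, write $u\perp x$ if $u\cap x$ has at most one element. For $U\subseteq\mathcal{P}(R)$ put $U^{\circ}=\{x\subseteq R\mid u\perp x\text{ for all }u\in U\}$. A concordance space $(R,U,X)$ consists of a set $R$ and subsets $U,X\subseteq\mathcal{P}(R)$ with $U=X^{\circ}$ and $X=U^{\circ}$. -}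

module Defs where

open import Data.Product using (_×_; _,_)
open import Data.Sum using (_⊎_)
open import Relation.Binary.PropositionalEquality using (_≡_)

Subset : Set → Set₁
Subset R = R → Set

Family : Set → Set₂
Family R = Subset R → Set₁

sing : {R : Set} → R → Subset R
sing r a = a ≡ r

pair : {R : Set} → R → R → Subset R
pair r r' a = (a ≡ r) ⊎ (a ≡ r')

_⊆_ : {R : Set} → Subset R → Subset R → Set
u ⊆ v = ∀ a → u a → v a

_⊥_ : {R : Set} → Subset R → Subset R → Set
u ⊥ x = ∀ a b → u a → x a → u b → x b → a ≡ b

_° : {R : Set} → Family R → Family R
(U °) x = ∀ u → U u → u ⊥ x

_≐_ : {R : Set} → Family R → Family R → Set₁
U ≐ V = ∀ s → (U s → V s) × (V s → U s)

IsConcordance : {R : Set} → Family R → Family R → Set₁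
IsConcordance U X = (U ≐ (X °)) × (X ≐ (U °))

DownwardClosed : {R : Set} → Family R → Set₁
DownwardClosed U = ∀ u u' → U u → u' ⊆ u → U u'

-- Everything follows from two properties shared by all polars V° : singletons
-- are orthogonal to every set, and orthogonality of u to x only involves pairs
-- of points of u, so V° is downward closed and determined by the pairs it
-- contains. A concordance space makes U and X polars of each other, and the
-- bipolar identity is then just U = X° = (U°)°. For (iv), if the pair {r, r'}
-- is not in X then by downward closure no member of X contains both points, so
-- {r, r'} ∈ X° = U; and {r, r'} cannot lie in both, since it meets itself twice.
module Submission where

open import Defs
open import Data.Product using (_×_; _,_; proj₁; proj₂)
open import Data.Sum using (_⊎_; inj₁; inj₂)
open import Data.Empty using (⊥-elim)
open import Relation.Nullary using (¬_; yes; no)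
open import Relation.Binary.PropositionalEquality using (_≡_; refl; sym; trans)
open import Level using (0ℓ) renaming (suc to lsuc)
open import Axiom.ExcludedMiddle using (ExcludedMiddle)

module _ {R : Set} where

  ⊥-sym : {u x : Subset R} → u ⊥ x → x ⊥ u
  ⊥-sym u⊥x a b xa ua xb ub = u⊥x a b ua xa ub xb

  ⊥-antitoneˡ : {u u' x : Subset R} → u' ⊆ u → u ⊥ x → u' ⊥ x
  ⊥-antitoneˡ u'⊆u u⊥x a b u'a xa u'b xb = u⊥x a b (u'⊆u a u'a) xa (u'⊆u b u'b) xb

  sing-⊥ : (r : R) {x : Subset R} → sing r ⊥ x
  sing-⊥ r a b a≡r _ b≡r _ = trans a≡r (sym b≡r)

  pair-⊆ : {s : Subset R} {r r' : R} → s r → s r' → pair r r' ⊆ s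
  pair-⊆ sr sr' _ (inj₁ refl) = sr
  pair-⊆ sr sr' _ (inj₂ refl) = sr'

  pairwise-⊥ : {u x : Subset R} → (∀ r r' → u r → u r' → pair r r' ⊥ x) → u ⊥ x
  pairwise-⊥ pairs⊥x a b ua xa ub xb =
    pairs⊥x a b ua ub a b (inj₁ refl) xa (inj₂ refl) xb

  ≐-trans : {U V W : Family R} → U ≐ V → V ≐ W → U ≐ W
  ≐-trans U≐V V≐W s = (λ Us → proj₁ (V≐W s) (proj₁ (U≐V s) Us))
                    , (λ Ws → proj₂ (U≐V s) (proj₂ (V≐W s) Ws))

  °-cong : {U V : Family R} → U ≐ V → (U °) ≐ (V °)
  °-cong U≐V x = (λ U°x v Vv → U°x v (proj₂ (U≐V v) Vv))
               , (λ V°x u Uu → V°x u (proj₁ (U≐V u) Uu))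

  sing∈° : (V : Family R) (r : R) → (V °) (sing r)
  sing∈° V r _ _ = ⊥-sym (sing-⊥ r)

  °-downwardClosed : (V : Family R) → DownwardClosed (V °)
  °-downwardClosed V x x' V°x x'⊆x v Vv =
    ⊥-sym (⊥-antitoneˡ x'⊆x (⊥-sym (V°x v Vv)))

  °-pairwise : (V : Family R) (x : Subset R) →
               (∀ r r' → x r → x r' → (V °) (pair r r')) → (V °) x
  °-pairwise V x pairs∈V° v Vv =
    ⊥-sym (pairwise-⊥ λ r r' xr xr' → ⊥-sym (pairs∈V° r r' xr xr' v Vv))

  pair∈°⇒≡ : {V : Family R} {r r' : R} → (V °) (pair r r') → V (pair r r') → r ≡ r'
  pair∈°⇒≡ pair∈V° pair∈V =
    pair∈V° _ pair∈V _ _ (inj₁ refl) (inj₁ refl) (inj₂ refl) (inj₂ refl)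

  pair∉⇒pair∈° : {V : Family R} → DownwardClosed V → {r r' : R} →
                 ¬ V (pair r r') → (V °) (pair r r')
  pair∉⇒pair∈° {V} V↓ {r} {r'} pair∉V x Vx = ⊥-sym pair⊥x
    where
    pair⊥x : pair r r' ⊥ x
    pair⊥x a b (inj₁ a≡r)  _  (inj₁ b≡r)  _  = trans a≡r (sym b≡r)
    pair⊥x a b (inj₂ a≡r') _  (inj₂ b≡r') _  = trans a≡r' (sym b≡r')
    pair⊥x _ _ (inj₁ refl) xa (inj₂ refl) xb = ⊥-elim (pair∉V (V↓ x _ Vx (pair-⊆ xa xb)))
    pair⊥x _ _ (inj₂ refl) xa (inj₁ refl) xb = ⊥-elim (pair∉V (V↓ x _ Vx (pair-⊆ xb xa)))

module _ {R : Set} {U X : Family R} (U≐X° : U ≐ (X °)) where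

  private
    °⇒ : ∀ {s} → (X °) s → U s
    °⇒ {s} = proj₂ (U≐X° s)

    ⇒° : ∀ {s} → U s → (X °) s
    ⇒° {s} = proj₁ (U≐X° s)

  sing∈ : (r : R) → U (sing r)
  sing∈ r = °⇒ (sing∈° X r)

  downwardClosed : DownwardClosed U
  downwardClosed u u' Uu u'⊆u = °⇒ (°-downwardClosed X u u' (⇒° Uu) u'⊆u)

  pairwise⇔ : ∀ u → (U u → ∀ r r' → u r → u r' → U (pair r r'))
                  × ((∀ r r' → u r → u r' → U (pair r r')) → U u)
  pairwise⇔ u = (λ Uu r r' ur ur' → downwardClosed u _ Uu (pair-⊆ ur ur'))
              , (λ pairs∈U → °⇒ (°-pairwise X u λ r r' ur ur' → ⇒° (pairs∈U r r' ur ur')))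

  pair-disjoint : {r r' : R} → ¬ (r ≡ r') → ¬ (U (pair r r') × X (pair r r'))
  pair-disjoint r≢r' (pair∈U , pair∈X) = r≢r' (pair∈°⇒≡ (⇒° pair∈U) pair∈X)

  pair∈⊎ : DownwardClosed X → (r r' : R) →
           ExcludedMiddle (lsuc 0ℓ) → U (pair r r') ⊎ X (pair r r')
  pair∈⊎ X↓ r r' em with em {X (pair r r')}
  ... | yes pair∈X = inj₂ pair∈X
  ... | no  pair∉X = inj₁ (°⇒ (pair∉⇒pair∈° X↓ pair∉X))

proposition5p3 : {R : Set} (U X : Family R) → IsConcordance U X →
    (∀ r → U (sing r) × X (sing r))
    × (DownwardClosed U × DownwardClosed X)
    × (U ≐ ((U °) °) × X ≐ ((X °) °))
    × (∀ r r' → (ExcludedMiddle (lsuc 0ℓ) → U (pair r r') ⊎ X (pair r r'))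
    × (¬ (r ≡ r') → ¬ (U (pair r r') × X (pair r r'))))
    × (∀ u → (U u → ∀ r r' → u r → u r' → U (pair r r'))
    × ((∀ r r' → u r → u r' → U (pair r r')) → U u))
    × (∀ x → (X x → ∀ r r' → x r → x r' → X (pair r r'))
    × ((∀ r r' → x r → x r' → X (pair r r')) → X x))
proposition5p3 U X (U≐X° , X≐U°) =
    (λ r → sing∈ U≐X° r , sing∈ X≐U° r)
  , (downwardClosed U≐X° , downwardClosed X≐U°)
  , (≐-trans U≐X° (°-cong X≐U°) , ≐-trans X≐U° (°-cong U≐X°))
  , (λ r r' → pair∈⊎ U≐X° (downwardClosed X≐U°) r r' , pair-disjoint U≐X°)
  , pairwise⇔ U≐X°
  , pairwise⇔ X≐U°
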